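{- Let $b, \beta \geq 2$ be integers and $q \in \mathbb{Q}_{\geq 0}$. Let $s = s_b(q)$, $t = t_b(q)$, $n = \lfloor q \rfloor$, and let $u, m$ be the integers with $0 \le u < b^s$, $0 \le m < b^t - 1$ and $$q = n + \frac{u}{b^s} + \frac{m}{b^s(b^t - 1)}.$$ Then $$c_{b,\beta}(q) = c_{b,\beta}(n) + \frac{c_{b,\beta}(u)}{\beta^s} + \frac{c_{b,\beta}(m)}{\beta^s(\beta^t - 1)}.$$
   Context: $s_b(q) := \min\{k \geq 0 : \text{denominator of } b^k q \text{ is prime to } b\}$, $t_b(q) := \min\{k \geq 1 : \text{denominator of } b^{s_b(q)} q \text{ divides } b^k - 1\}$. Every real $x \ge 0$ has a unique normal base-$b$ expansion $x=\sum_i x_i b^i$ (digits in $\{0,\dots,b-1\}$, $x_i=0$ for $i\gg0$, not ending in infinitely many digits $b-1$), and $c_{b,\beta}(x) := \sum_i x_i\beta^i$. -}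

module Defs where

open import Data.Nat as ℕ using (ℕ; zero; suc; _^_; _∸_)
open import Data.Nat.DivMod using (_%_; _/_)
open import Data.Integer as ℤ using (ℤ; +_)
open import Data.Rational as ℚ using (ℚ; 0ℚ; ∣_∣)
open import Data.Product using (Σ; ∃; _×_)
open import Relation.Nullary using (¬_)
open import Relation.Binary.PropositionalEquality using (_≡_)

-- the rational n / d (for d > 0; junk value 0 when d = 0, never used)
divℚ : ℕ → ℕ → ℚ
divℚ n zero    = 0ℚ
divℚ n (suc d) = (+ n) ℚ./ suc d

natℚ : ℕ → ℚ
natℚ n = divℚ n 1

sumTo : (ℕ → ℕ) → ℕ → ℕ
sumTo f zero    = 0
sumTo f (suc n) = sumTo f n ℕ.+ f n

-- A digit sequence is d : ℤ → ℕ (d i = the digit at position i, weight x^i),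
-- with d i = 0 for all i ≥ K.  The k-th partial sum of Σ_i d_i x^i is
--   Σ_{i = -k}^{K-1} d_i x^i  =  (Σ_{j=0}^{K+k-1} d_{j-k} x^j) / x^k .
partialSum : (x : ℕ) → (ℤ → ℕ) → (K : ℕ) → ℕ → ℚ
partialSum x d K k =
  divℚ (sumTo (λ j → d (+ j ℤ.- + k) ℕ.* x ^ j) (K ℕ.+ k)) (x ^ k)

ConvergesTo : (ℕ → ℚ) → ℚ → Set
ConvergesTo s L =
  (ε : ℚ) → 0ℚ ℚ.< ε → ∃ λ N → (k : ℕ) → N ℕ.≤ k → ∣ s k ℚ.- L ∣ ℚ.< ε

IsNormalExpansion : (b : ℕ) → ℚ → (ℤ → ℕ) → ℕ → Set
IsNormalExpansion b x d K =
  ((i : ℤ) → d i ℕ.< b) ×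
  ((i : ℤ) → + K ℤ.≤ i → d i ≡ 0) ×
  ConvergesTo (partialSum b d K) x ×
  ¬ (∃ λ (M : ℕ) → (i : ℤ) → i ℤ.≤ ℤ.- (+ M) → d i ≡ b ∸ 1)

HasCValue : (b β : ℕ) → ℚ → ℚ → Set
HasCValue b β x C =
  (d : ℤ → ℕ) (K : ℕ) → IsNormalExpansion b x d K → ConvergesTo (partialSum β d K) C

-- c_{b,β} on natural numbers: replace base-b digits by weights β^i
-- (fuel-based recursion; fuel n suffices since n has at most n digits when b ≥ 2)
cNatFuel : ℕ → (b β : ℕ) → ℕ → ℕ
cNatFuel zero    b       β n = 0
cNatFuel (suc f) zero    β n = 0
cNatFuel (suc f) (suc b) β n = n % suc b ℕ.+ β ℕ.* cNatFuel f (suc b) β (n / suc b)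

cNat : (b β : ℕ) → ℕ → ℕ
cNat b β n = cNatFuel n b β n

IsLeast : (ℕ → Set) → ℕ → Set
IsLeast P s = P s × ((k : ℕ) → k ℕ.< s → ¬ P k)

scale : ℕ → ℕ → ℚ → ℚ
scale b k q = natℚ (b ^ k) ℚ.* q

IsS : (b : ℕ) → ℚ → ℕ → Set
IsS b q = IsLeast (λ k → Coprime′ (ℚ.denominatorℕ (scale b k q)) b)
  where open import Data.Nat.Coprimality renaming (Coprime to Coprime′)

IsT : (b : ℕ) → ℚ → (s : ℕ) → ℕ → Set
IsT b q s = IsLeast (λ k → (1 ℕ.≤ k) × (ℚ.denominatorℕ (scale b s q) ∣ (b ^ k ∸ 1)))
  where open import Data.Nat.Divisibility using (_∣_)

{-# OPTIONS --safe #-}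
-- Let A_k be b^k times the k-th partial sum of the normal expansion of q.  The partial
-- sums A_k/b^k increase to q and the upper sums (A_k+1)/b^k decrease to q, strictly at
-- every digit below b-1; as such digits occur arbitrarily far out, A_k = ⌊b^k q⌋.  At the
-- levels k = s+tj we have b^k q = F_j + m/(b^t-1) with F_0 = n b^s + u and
-- F_(j+1) = F_j b^t + m, so A_k = F_j: the digit string of A_k is that of n, then u
-- padded to s digits, then j copies of m padded to t digits.  Replacing base-b digits by
-- powers of β respects such concatenations, so the β-partial sum at level s+tj equals the
-- claimed value minus c(m)/(β^(s+tj)(β^t-1)).  The β-partial sums increase, hence converge
-- to the claimed value.
module Submission where

open import Defs
open import Data.Nat as ℕ
  using (ℕ; zero; suc; _^_; _∸_; _+_; _*_; _≤_; _<_; z≤n; s≤s; s≤s⁻¹; z<s; NonZero; >-nonZero)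
open import Data.Nat.Properties
open import Data.Nat.DivMod
  using (_%_; _/_; m≡m%n+[m/n]*n; m%n<n; m/n≤m; m/n<m; [m+kn]%n≡m%n; m<n⇒m%n≡m; m<n⇒m/n≡0;
         m*n%n≡0; m*n/n≡m; +-distrib-/; m<n*o⇒m/o<n)
open import Data.Nat.Solver using (module +-*-Solver)
open import Data.Integer as ℤ using (ℤ; +_; -[1+_])
import Data.Integer.Properties as ℤP
open import Data.Rational as ℚ using (ℚ; 0ℚ; ∣_∣; toℚᵘ)
import Data.Rational.Properties as ℚP
open import Data.Rational.Unnormalised as ℚᵘ using (mkℚᵘ; *≤*; *<*; *≡*)
import Data.Rational.Unnormalised.Properties as ℚᵘP
open import Algebra.Properties.AbelianGroup ℚP.+-0-abelianGroup using (⁻¹-anti-homo‿-; xyx⁻¹≈y)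
open import Data.Product using (∃; _,_; proj₁; proj₂)
open import Data.Sum using (inj₁; inj₂)
open import Relation.Nullary using (yes; no)
open import Data.Empty using (⊥-elim)
open import Relation.Binary.PropositionalEquality
open import Algebra.Properties.CommutativeSemigroup *-commutativeSemigroup
  using () renaming (x∙yz≈y∙xz to *-left-comm)
open +-*-Solver using (solve; _:=_; _:+_; _:*_; con)

^-pos : ∀ {x} → 0 < x → ∀ k → 0 < x ^ k
^-pos {x} 0<x = m^n>0 x {{>-nonZero 0<x}}

n<xⁿ : ∀ {x} → 1 < x → ∀ n → n < x ^ n
n<xⁿ 1<x zero    = z<s
n<xⁿ {x} 1<x (suc n) = begin-strict
  suc n        ≤⟨ n<xⁿ 1<x n ⟩
  x ^ n        <⟨ m<m*n (x ^ n) x {{>-nonZero (^-pos (<-trans z<s 1<x) n)}} 1<x ⟩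
  x ^ n * x    ≡⟨ *-comm (x ^ n) x ⟩
  x ^ suc n    ∎
  where open ≤-Reasoning

0<xᵗ∸1⇒0<t : ∀ {x} t → 0 < x ^ t ∸ 1 → 0 < t
0<xᵗ∸1⇒0<t zero    ()
0<xᵗ∸1⇒0<t (suc t) _ = z<s

0<xᵗ∸1 : ∀ {x t} → 1 < x → 0 < t → 0 < x ^ t ∸ 1
0<xᵗ∸1 {x} {t} 1<x 0<t = m<n⇒0<n∸m (<-≤-trans 1<x (subst (_≤ x ^ t) (*-identityʳ x)
  (^-monoʳ-≤ x {{>-nonZero (<-trans z<s 1<x)}} 0<t)))

private
  *-rotate : ∀ c x W → c * (x * W) ≡ x * c * W
  *-rotate c x W = trans (*-left-comm c x W) (sym (*-assoc x c W))

  +b*≤b*suc : ∀ {h b} A → h ≤ b → h + b * A ≤ b * suc A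
  +b*≤b*suc {h} {b} A h≤b = subst (h + b * A ≤_) (sym (*-suc b A)) (+-monoˡ-≤ (b * A) h≤b)

sumTo-cong : ∀ {f g} L → (∀ j → f j ≡ g j) → sumTo f L ≡ sumTo g L
sumTo-cong zero    f≗g = refl
sumTo-cong (suc L) f≗g = cong₂ _+_ (sumTo-cong L f≗g) (f≗g L)

sumTo-*ˡ : ∀ c f L → sumTo (λ j → c * f j) L ≡ c * sumTo f L
sumTo-*ˡ c f zero    = sym (*-zeroʳ c)
sumTo-*ˡ c f (suc L) =
  trans (cong (_+ c * f L) (sumTo-*ˡ c f L)) (sym (*-distribˡ-+ c (sumTo f L) (f L)))

sumTo-suc : ∀ f L → sumTo f (suc L) ≡ f 0 + sumTo (λ j → f (suc j)) L
sumTo-suc f zero    = +-comm 0 (f 0)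
sumTo-suc f (suc L) = trans (cong (_+ f (suc L)) (sumTo-suc f L)) (+-assoc (f 0) _ _)

digitSum : ℕ → (ℕ → ℕ) → ℕ → ℕ
digitSum x g L = sumTo (λ j → g j * x ^ j) L

digitSum-cong : ∀ x {g h} L → (∀ j → g j ≡ h j) → digitSum x g L ≡ digitSum x h L
digitSum-cong x L g≗h = sumTo-cong L (λ j → cong (_* x ^ j) (g≗h j))

digitSum-suc : ∀ x g L → digitSum x g (suc L) ≡ g 0 + x * digitSum x (λ j → g (suc j)) L
digitSum-suc x g L = begin
  digitSum x g (suc L)                               ≡⟨ sumTo-suc (λ j → g j * x ^ j) L ⟩
  g 0 * 1 + sumTo (λ j → g (suc j) * (x * x ^ j)) L  ≡⟨ cong₂ _+_ (*-identityʳ (g 0)) shift ⟩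
  g 0 + x * digitSum x (λ j → g (suc j)) L           ∎
  where
  open ≡-Reasoning
  shift : sumTo (λ j → g (suc j) * (x * x ^ j)) L ≡ x * digitSum x (λ j → g (suc j)) L
  shift = trans (sumTo-cong L (λ j → *-left-comm (g (suc j)) x (x ^ j)))
                (sumTo-*ˡ x (λ j → g (suc j) * x ^ j) L)

affineIterate : ℕ → ℕ → ℕ → ℕ → ℕ
affineIterate T m F₀ zero    = F₀
affineIterate T m F₀ (suc j) = affineIterate T m F₀ j * T + m

affineIterate-closed : ∀ {T Q} m F₀ j → T ≡ suc Q →
  affineIterate T m F₀ j * Q + m ≡ (F₀ * Q + m) * T ^ j
affineIterate-closed {T} {Q} m F₀ zero    _      = sym (*-identityʳ _)
affineIterate-closed {T} {Q} m F₀ (suc j) refl = begin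
  (F * T + m) * Q + m           ≡⟨ solve 3 (λ F Q m → (F :* (con 1 :+ Q) :+ m) :* Q :+ m
                                              := (con 1 :+ Q) :* (F :* Q :+ m)) refl F Q m ⟩
  T * (F * Q + m)               ≡⟨ cong (T *_) (affineIterate-closed m F₀ j refl) ⟩
  T * ((F₀ * Q + m) * T ^ j)    ≡⟨ *-left-comm T (F₀ * Q + m) (T ^ j) ⟩
  (F₀ * Q + m) * T ^ suc j      ∎
  where
  open ≡-Reasoning
  F = affineIterate T m F₀ j

cNatFuel-suc : ∀ f b β n .{{_ : NonZero b}} →
  cNatFuel (suc f) b β n ≡ n % b + β * cNatFuel f b β (n / b)
cNatFuel-suc f (suc b) β n = refl

cNatFuel-0 : ∀ f b β → cNatFuel f b β 0 ≡ 0
cNatFuel-0 zero    b       β = refl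
cNatFuel-0 (suc f) zero    β = refl
cNatFuel-0 (suc f) (suc b) β = trans (cong (β *_) (cNatFuel-0 f (suc b) β)) (*-zeroʳ β)

module _ (b β : ℕ) (1<b : 1 < b) where

  private instance
    b≢0 : NonZero b
    b≢0 = >-nonZero (<-trans z<s 1<b)

  private
    /b≤pred : ∀ n {f} → n ≤ suc f → n / b ≤ f
    /b≤pred zero    _   = ≤-trans (m/n≤m 0 b) z≤n
    /b≤pred (suc m) m<f = <⇒≤pred (≤-trans (m/n<m (suc m) b 1<b) m<f)

  cNatFuel-irrelevant : ∀ {f f′ n} → n ≤ f → n ≤ f′ → cNatFuel f b β n ≡ cNatFuel f′ b β n
  cNatFuel-irrelevant {zero}  {f′}     {zero} _ _ = sym (cNatFuel-0 f′ b β)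
  cNatFuel-irrelevant {suc f} {zero}   {zero} _ _ = cNatFuel-0 (suc f) b β
  cNatFuel-irrelevant {suc f} {suc f′} {n} n≤f n≤f′ = begin
    cNatFuel (suc f) b β n                   ≡⟨ cNatFuel-suc f b β n ⟩
    n % b + β * cNatFuel f b β (n / b)       ≡⟨ cong (λ c → n % b + β * c) IH ⟩
    n % b + β * cNatFuel f′ b β (n / b)      ≡⟨ cNatFuel-suc f′ b β n ⟨
    cNatFuel (suc f′) b β n                  ∎
    where
    open ≡-Reasoning
    IH = cNatFuel-irrelevant (/b≤pred n n≤f) (/b≤pred n n≤f′)

  cNat-unfold : ∀ n → cNat b β n ≡ n % b + β * cNat b β (n / b)
  cNat-unfold n = begin
    cNatFuel n b β n                      ≡⟨ cNatFuel-irrelevant ≤-refl (n≤1+n n) ⟩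
    cNatFuel (suc n) b β n                ≡⟨ cNatFuel-suc n b β n ⟩
    n % b + β * cNatFuel n b β (n / b)    ≡⟨ cong (λ c → n % b + β * c) fuel ⟩
    n % b + β * cNat b β (n / b)          ∎
    where
    open ≡-Reasoning
    fuel = cNatFuel-irrelevant (m/n≤m n b) ≤-refl

  private
    digit-% : ∀ {g} X → g < b → (g + b * X) % b ≡ g
    digit-% {g} X g<b = begin
      (g + b * X) % b  ≡⟨ cong (λ y → (g + y) % b) (*-comm b X) ⟩
      (g + X * b) % b  ≡⟨ [m+kn]%n≡m%n g X b ⟩
      g % b            ≡⟨ m<n⇒m%n≡m g<b ⟩
      g                ∎
      where open ≡-Reasoning

    digit-/ : ∀ {g} X → g < b → (g + b * X) / b ≡ X
    digit-/ {g} X g<b = begin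
      (g + b * X) / b    ≡⟨ cong (λ y → (g + y) / b) (*-comm b X) ⟩
      (g + X * b) / b    ≡⟨ +-distrib-/ g (X * b) no-carry ⟩
      g / b + X * b / b  ≡⟨ cong₂ _+_ (m<n⇒m/n≡0 g<b) (m*n/n≡m X b) ⟩
      X                  ∎
      where
      open ≡-Reasoning
      no-carry : g % b + X * b % b < b
      no-carry = subst (_< b) (sym (trans (cong₂ _+_ (m<n⇒m%n≡m g<b) (m*n%n≡0 X b)) (+-identityʳ g))) g<b

  cNat-digit : ∀ {g} X → g < b → cNat b β (g + b * X) ≡ g + β * cNat b β X
  cNat-digit {g} X g<b = trans (cNat-unfold (g + b * X))
    (cong₂ (λ r q → r + β * cNat b β q) (digit-% X g<b) (digit-/ X g<b))

  cNat-digitSum : ∀ g L → (∀ j → g j < b) → cNat b β (digitSum b g L) ≡ digitSum β g L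
  cNat-digitSum g zero    g<b = refl
  cNat-digitSum g (suc L) g<b = begin
    cNat b β (digitSum b g (suc L))                       ≡⟨ cong (cNat b β) (digitSum-suc b g L) ⟩
    cNat b β (g 0 + b * digitSum b (λ j → g (suc j)) L)   ≡⟨ cNat-digit _ (g<b 0) ⟩
    g 0 + β * cNat b β (digitSum b (λ j → g (suc j)) L)   ≡⟨ cong (λ c → g 0 + β * c) IH ⟩
    g 0 + β * digitSum β (λ j → g (suc j)) L              ≡⟨ digitSum-suc β g L ⟨
    digitSum β g (suc L)                                  ∎
    where
    open ≡-Reasoning
    IH = cNat-digitSum (λ j → g (suc j)) L (λ j → g<b (suc j))

  cNat-concat : ∀ L X Y → Y < b ^ L → cNat b β (X * b ^ L + Y) ≡ cNat b β X * β ^ L + cNat b β Y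
  cNat-concat zero X zero _ = begin
    cNat b β (X * 1 + 0)   ≡⟨ cong (cNat b β) (trans (+-identityʳ _) (*-identityʳ X)) ⟩
    cNat b β X             ≡⟨ trans (+-identityʳ _) (*-identityʳ _) ⟨
    cNat b β X * 1 + 0     ∎
    where open ≡-Reasoning
  cNat-concat zero X (suc Y) (s≤s ())
  cNat-concat (suc L) X Y Y<b^L+1 = begin
    cNat b β (X * b ^ suc L + Y)                   ≡⟨ cong (cNat b β) regroup ⟩
    cNat b β (Y % b + b * (X * b ^ L + Y / b))     ≡⟨ cNat-digit _ (m%n<n Y b) ⟩
    Y % b + β * cNat b β (X * b ^ L + Y / b)       ≡⟨ cong (λ c → Y % b + β * c) IH ⟩
    Y % b + β * (cX * β ^ L + cNat b β (Y / b))    ≡⟨ solve 5 (λ r B x p y → r :+ B :* (x :* p :+ y)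
                                                                 := x :* (B :* p) :+ (r :+ B :* y))
                                                       refl (Y % b) β cX (β ^ L) (cNat b β (Y / b)) ⟩
    cX * β ^ suc L + (Y % b + β * cNat b β (Y / b)) ≡⟨ cong (λ c → cX * β ^ suc L + c) (cNat-unfold Y) ⟨
    cX * β ^ suc L + cNat b β Y                    ∎
    where
    open ≡-Reasoning
    cX = cNat b β X
    regroup : X * b ^ suc L + Y ≡ Y % b + b * (X * b ^ L + Y / b)
    regroup = trans (cong (λ y → X * b ^ suc L + y) (m≡m%n+[m/n]*n Y b))
      (solve 5 (λ x B p r y → x :* (B :* p) :+ (r :+ y :* B) := r :+ B :* (x :* p :+ y))
        refl X b (b ^ L) (Y % b) (Y / b))
    IH = cNat-concat L X (Y / b) (m<n*o⇒m/o<n (subst (Y <_) (*-comm b (b ^ L)) Y<b^L+1))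

cNat-affineIterate : ∀ {b} β → 1 < b → ∀ {t m} F₀ → m < b ^ t → ∀ j →
  cNat b β (affineIterate (b ^ t) m F₀ j) ≡ affineIterate (β ^ t) (cNat b β m) (cNat b β F₀) j
cNat-affineIterate β 1<b F₀ m<bᵗ zero = refl
cNat-affineIterate {b} β 1<b {t} {m} F₀ m<bᵗ (suc j) =
  trans (cNat-concat b β 1<b t (affineIterate (b ^ t) m F₀ j) m m<bᵗ)
        (cong (λ c → c * β ^ t + cNat b β m) (cNat-affineIterate β 1<b {t} F₀ m<bᵗ j))

toℚᵘ-divℚ : ∀ a x → toℚᵘ (divℚ a (suc x)) ℚᵘ.≃ mkℚᵘ (+ a) x
toℚᵘ-divℚ a x = ℚP.toℚᵘ-fromℚᵘ (mkℚᵘ (+ a) x)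

divℚ-≤ : ∀ {a x c y} → 0 < x → 0 < y → a * y ≤ c * x → divℚ a x ℚ.≤ divℚ c y
divℚ-≤ {a} {suc x} {c} {suc y} z<s z<s ay≤cx = ℚP.toℚᵘ-cancel-≤
  (ℚᵘP.≤-respˡ-≃ (ℚᵘP.≃-sym (toℚᵘ-divℚ a x)) (ℚᵘP.≤-respʳ-≃ (ℚᵘP.≃-sym (toℚᵘ-divℚ c y))
    (*≤* (subst₂ ℤ._≤_ (ℤP.pos-* a (suc y)) (ℤP.pos-* c (suc x)) (ℤ.+≤+ ay≤cx)))))

divℚ-< : ∀ {a x c y} → 0 < x → 0 < y → a * y < c * x → divℚ a x ℚ.< divℚ c y
divℚ-< {a} {suc x} {c} {suc y} z<s z<s ay<cx = ℚP.toℚᵘ-cancel-<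
  (ℚᵘP.<-respˡ-≃ (ℚᵘP.≃-sym (toℚᵘ-divℚ a x)) (ℚᵘP.<-respʳ-≃ (ℚᵘP.≃-sym (toℚᵘ-divℚ c y))
    (*<* (subst₂ ℤ._<_ (ℤP.pos-* a (suc y)) (ℤP.pos-* c (suc x)) (ℤ.+<+ ay<cx)))))

divℚ-<⁻¹ : ∀ {a x c y} → 0 < x → 0 < y → divℚ a x ℚ.< divℚ c y → a * y < c * x
divℚ-<⁻¹ {a} {suc x} {c} {suc y} z<s z<s a/x<c/y
  with ℚᵘP.<-respˡ-≃ (toℚᵘ-divℚ a x) (ℚᵘP.<-respʳ-≃ (toℚᵘ-divℚ c y) (ℚP.toℚᵘ-mono-< a/x<c/y))
... | *<* ay<cx = ℤP.drop‿+<+ (subst₂ ℤ._<_ (sym (ℤP.pos-* a (suc y))) (sym (ℤP.pos-* c (suc x))) ay<cx)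

divℚ-≡ : ∀ {a x c y} → 0 < x → 0 < y → a * y ≡ c * x → divℚ a x ≡ divℚ c y
divℚ-≡ {a} {suc x} {c} {suc y} z<s z<s ay≡cx = ℚP.toℚᵘ-injective
  (ℚᵘP.≃-trans (toℚᵘ-divℚ a x) (ℚᵘP.≃-trans
    (*≡* (trans (sym (ℤP.pos-* a (suc y))) (trans (cong +_ ay≡cx) (ℤP.pos-* c (suc x)))))
    (ℚᵘP.≃-sym (toℚᵘ-divℚ c y))))

divℚ-+ : ∀ {a x c y} → 0 < x → 0 < y → divℚ a x ℚ.+ divℚ c y ≡ divℚ (a * y + c * x) (x * y)
divℚ-+ {a} {suc x} {c} {suc y} z<s z<s = ℚP.toℚᵘ-injective
  (ℚᵘP.≃-trans (ℚP.toℚᵘ-homo-+ (divℚ a (suc x)) (divℚ c (suc y)))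
  (ℚᵘP.≃-trans (ℚᵘP.+-cong (toℚᵘ-divℚ a x) (toℚᵘ-divℚ c y))
  (ℚᵘP.≃-trans (ℚᵘP.≃-reflexive (cong₂ mkℚᵘ numerator refl))
    (ℚᵘP.≃-sym (toℚᵘ-divℚ (a * suc y + c * suc x) _)))))
  where
  numerator : + a ℤ.* + suc y ℤ.+ + c ℤ.* + suc x ≡ + (a * suc y + c * suc x)
  numerator = sym (trans (ℤP.pos-+ (a * suc y) (c * suc x))
                         (cong₂ ℤ._+_ (ℤP.pos-* a (suc y)) (ℤP.pos-* c (suc x))))

divℚ-+-refine : ∀ a m {W Q} → 0 < W → 0 < Q →
  divℚ a W ℚ.+ divℚ m (W * Q) ≡ divℚ (a * Q + m) (W * Q)
divℚ-+-refine a m {W} {Q} 0<W 0<Q =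
  trans (divℚ-+ 0<W 0<WQ) (divℚ-≡ (*-mono-< 0<W 0<WQ) 0<WQ
    (solve 4 (λ a m W Q → (a :* (W :* Q) :+ m :* W) :* (W :* Q) := (a :* Q :+ m) :* (W :* (W :* Q)))
       refl a m W Q))
  where 0<WQ = *-mono-< 0<W 0<Q

natℚ-+-divℚ : ∀ n u {B} → 0 < B → natℚ n ℚ.+ divℚ u B ≡ divℚ (n * B + u) B
natℚ-+-divℚ n u {B} 0<B = trans (divℚ-+ {n} {1} z<s 0<B) (divℚ-≡ (≤-trans 0<B (m≤n*m B 1)) 0<B
  (solve 3 (λ n u B → (n :* B :+ u :* con 1) :* B := (n :* B :+ u) :* (con 1 :* B)) refl n u B))

divℚ-≤-refine : ∀ a m {W Q} → 0 < W → 0 < Q → divℚ a W ℚ.≤ divℚ (a * Q + m) (W * Q)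
divℚ-≤-refine a m {W} {Q} 0<W 0<Q = divℚ-≤ 0<W (*-mono-< 0<W 0<Q) (begin
  a * (W * Q)      ≡⟨ solve 3 (λ a W Q → a :* (W :* Q) := a :* Q :* W) refl a W Q ⟩
  a * Q * W        ≤⟨ *-monoˡ-≤ W (m≤m+n (a * Q) m) ⟩
  (a * Q + m) * W  ∎)
  where open ≤-Reasoning

divℚ-refine-< : ∀ a m {W Q} → 0 < W → m < Q → divℚ (a * Q + m) (W * Q) ℚ.< divℚ (suc a) W
divℚ-refine-< a m {W} {Q} 0<W m<Q = divℚ-< (*-mono-< 0<W (≤-<-trans z≤n m<Q)) 0<W (begin-strict
  (a * Q + m) * W  <⟨ *-monoˡ-< W {{>-nonZero 0<W}} (+-monoʳ-< (a * Q) m<Q) ⟩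
  (a * Q + Q) * W  ≡⟨ solve 3 (λ a W Q → (a :* Q :+ Q) :* W := (con 1 :+ a) :* (W :* Q)) refl a W Q ⟩
  suc a * (W * Q)  ∎)
  where open ≤-Reasoning

divℚ-floor-≤ : ∀ {a c D q} → 0 < D → divℚ a D ℚ.≤ q → q ℚ.< divℚ (suc c) D → a ≤ c
divℚ-floor-≤ {a} {c} {D} 0<D a/D≤q q<c+1/D = s≤s⁻¹
  (*-cancelʳ-< D a (suc c) (divℚ-<⁻¹ 0<D 0<D (ℚP.≤-<-trans a/D≤q q<c+1/D)))

divℚ-≤-* : ∀ {a c x W} → 0 < x → 0 < W → x * c ≤ a → divℚ c W ℚ.≤ divℚ a (x * W)
divℚ-≤-* {a} {c} {x} {W} 0<x 0<W xc≤a = divℚ-≤ 0<W (*-mono-< 0<x 0<W)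
  (subst (_≤ a * W) (sym (*-rotate c x W)) (*-monoˡ-≤ W xc≤a))

divℚ-*-≤ : ∀ {a c x W} → 0 < x → 0 < W → a ≤ x * c → divℚ a (x * W) ℚ.≤ divℚ c W
divℚ-*-≤ {a} {c} {x} {W} 0<x 0<W a≤xc = divℚ-≤ (*-mono-< 0<x 0<W) 0<W
  (subst (a * W ≤_) (sym (*-rotate c x W)) (*-monoˡ-≤ W a≤xc))

divℚ-*-< : ∀ {a c x W} → 0 < x → 0 < W → a < x * c → divℚ a (x * W) ℚ.< divℚ c W
divℚ-*-< {a} {c} {x} {W} 0<x 0<W a<xc = divℚ-< (*-mono-< 0<x 0<W) 0<W
  (subst (a * W <_) (sym (*-rotate c x W)) (*-monoˡ-< W {{>-nonZero 0<W}} a<xc))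

pos⇒divℚ : ∀ ε → 0ℚ ℚ.< ε → ∃ λ p → ∃ λ r → ε ≡ divℚ (suc p) (suc r)
pos⇒divℚ ε@(ℚ.mkℚ ℤ.+[1+ p ] r _) _ = p , r , sym (ℚP.fromℚᵘ-toℚᵘ ε)
pos⇒divℚ ε@(ℚ.mkℚ (+ 0)      r _) 0<ε with ℚ.positive 0<ε
... | ()
pos⇒divℚ ε@(ℚ.mkℚ -[1+ p ]   r _) 0<ε with ℚ.positive 0<ε
... | ()

divℚ-archimedean : ∀ a ε → 0ℚ ℚ.< ε → ∃ λ D₀ → ∀ {D} → D₀ ≤ D → divℚ a D ℚ.< ε
divℚ-archimedean a ε 0<ε with pos⇒divℚ ε 0<ε
... | p , r , refl = suc (a * suc r) , λ {D} D₀≤D →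
  divℚ-< {a} {D} {suc p} {suc r} (≤-trans z<s D₀≤D) z<s (begin-strict
  a * suc r    <⟨ D₀≤D ⟩
  D            ≤⟨ m≤n*m D (suc p) ⟩
  suc p * D    ∎)
  where open ≤-Reasoning

p≤∣p∣ : ∀ p → p ℚ.≤ ∣ p ∣
p≤∣p∣ p with ℚP.≤-total 0ℚ p
... | inj₁ 0≤p = ℚP.≤-reflexive (sym (ℚP.0≤p⇒∣p∣≡p 0≤p))
... | inj₂ p≤0 = ℚP.≤-trans p≤0 (ℚP.0≤∣p∣ p)

-p≤∣p∣ : ∀ p → ℚ.- p ℚ.≤ ∣ p ∣
-p≤∣p∣ p = subst (ℚ.- p ℚ.≤_) (ℚP.∣-p∣≡∣p∣ p) (p≤∣p∣ (ℚ.- p))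

p≤q⇒0≤q-p : ∀ {p q} → p ℚ.≤ q → 0ℚ ℚ.≤ q ℚ.- p
p≤q⇒0≤q-p {p} {q} p≤q = subst (ℚ._≤ q ℚ.- p) (ℚP.+-inverseʳ p) (ℚP.+-monoˡ-≤ (ℚ.- p) p≤q)

p<q⇒0<q-p : ∀ {p q} → p ℚ.< q → 0ℚ ℚ.< q ℚ.- p
p<q⇒0<q-p {p} {q} p<q = subst (ℚ._< q ℚ.- p) (ℚP.+-inverseʳ p) (ℚP.+-monoˡ-< (ℚ.- p) p<q)

module _ {f : ℕ → ℚ} {L : ℚ} (f→L : ConvergesTo f L) where

  limit-≤ : ∀ {c} N → (∀ k → N ≤ k → f k ℚ.≤ c) → L ℚ.≤ c
  limit-≤ {c} N f≤c with L ℚP.≤? c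
  ... | yes L≤c = L≤c
  ... | no  L≰c = ⊥-elim (ℚP.<-irrefl refl (begin-strict
    L ℚ.- c          ≤⟨ ℚP.+-monoʳ-≤ L (ℚP.neg-antimono-≤ (f≤c k (m≤m+n N N′))) ⟩
    L ℚ.- f k        ≡⟨ ⁻¹-anti-homo‿- (f k) L ⟨
    ℚ.- (f k ℚ.- L)  ≤⟨ -p≤∣p∣ (f k ℚ.- L) ⟩
    ∣ f k ℚ.- L ∣    <⟨ close k (m≤n+m N′ N) ⟩
    L ℚ.- c          ∎))
    where
    open ℚP.≤-Reasoning
    ε>0 = p<q⇒0<q-p (ℚP.≰⇒> L≰c)
    N′ = proj₁ (f→L (L ℚ.- c) ε>0)
    close = proj₂ (f→L (L ℚ.- c) ε>0)
    k = N + N′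

  ≤-limit : ∀ {c} N → (∀ k → N ≤ k → c ℚ.≤ f k) → c ℚ.≤ L
  ≤-limit {c} N c≤f with c ℚP.≤? L
  ... | yes c≤L = c≤L
  ... | no  c≰L = ⊥-elim (ℚP.<-irrefl refl (begin-strict
    c ℚ.- L          ≤⟨ ℚP.+-monoˡ-≤ (ℚ.- L) (c≤f k (m≤m+n N N′)) ⟩
    f k ℚ.- L        ≤⟨ p≤∣p∣ (f k ℚ.- L) ⟩
    ∣ f k ℚ.- L ∣    <⟨ close k (m≤n+m N′ N) ⟩
    c ℚ.- L          ∎))
    where
    open ℚP.≤-Reasoning
    ε>0 = p<q⇒0<q-p (ℚP.≰⇒> c≰L)
    N′ = proj₁ (f→L (c ℚ.- L) ε>0)
    close = proj₂ (f→L (c ℚ.- L) ε>0)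
    k = N + N′

module _ {A : Set} {ℓ} {_∼_ : A → A → Set ℓ} (∼-refl : ∀ {x} → x ∼ x)
         (∼-trans : ∀ {x y z} → x ∼ y → y ∼ z → x ∼ z) (f : ℕ → A) where

  stepwise⇒monotone : (∀ k → f k ∼ f (suc k)) → ∀ {m n} → m ≤ n → f m ∼ f n
  stepwise⇒monotone step m≤n = go (≤⇒≤′ m≤n)
    where
    go : ∀ {m n} → m ℕ.≤′ n → f m ∼ f n
    go ℕ.≤′-refl       = ∼-refl
    go (ℕ.≤′-step m≤n) = ∼-trans (go m≤n) (step _)

increasing-bounded⇒ConvergesTo : ∀ {f L} →
  (∀ {m n} → m ≤ n → f m ℚ.≤ f n) → (∀ k → f k ℚ.≤ L) →
  (∀ ε → 0ℚ ℚ.< ε → ∃ λ N → L ℚ.- f N ℚ.< ε) → ConvergesTo f L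
increasing-bounded⇒ConvergesTo {f} {L} mono f≤L approach ε ε>0 with approach ε ε>0
... | N , L-fN<ε = N , λ k N≤k → begin-strict
  ∣ f k ℚ.- L ∣           ≡⟨ cong ∣_∣ (⁻¹-anti-homo‿- L (f k)) ⟨
  ∣ ℚ.- (L ℚ.- f k) ∣     ≡⟨ ℚP.∣-p∣≡∣p∣ (L ℚ.- f k) ⟩
  ∣ L ℚ.- f k ∣           ≡⟨ ℚP.0≤p⇒∣p∣≡p (p≤q⇒0≤q-p (f≤L k)) ⟩
  L ℚ.- f k               ≤⟨ ℚP.+-monoʳ-≤ L (ℚP.neg-antimono-≤ (mono N≤k)) ⟩
  L ℚ.- f N               <⟨ L-fN<ε ⟩
  ε                       ∎
  where open ℚP.≤-Reasoning

partialNumerator : ℕ → (ℤ → ℕ) → ℕ → ℕ → ℕ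
partialNumerator x d K k = digitSum x (λ j → d (+ j ℤ.- + k)) (K + k)

upperSum : ℕ → (ℤ → ℕ) → ℕ → ℕ → ℚ
upperSum x d K k = divℚ (suc (partialNumerator x d K k)) (x ^ k)

+[1+j]-+[1+k] : ∀ j k → + suc j ℤ.- + suc k ≡ + j ℤ.- + k
+[1+j]-+[1+k] j k = trans (ℤP.[1+m]⊖[1+n]≡m⊖n j k) (sym (ℤP.m-n≡m⊖n j k))

partialNumerator-suc : ∀ x d K k →
  partialNumerator x d K (suc k) ≡ d -[1+ k ] + x * partialNumerator x d K k
partialNumerator-suc x d K k = begin
  digitSum x digits (K + suc k)                              ≡⟨ cong (digitSum x digits) (+-suc K k) ⟩
  digitSum x digits (suc (K + k))                            ≡⟨ digitSum-suc x digits (K + k) ⟩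
  d -[1+ k ] + x * digitSum x (λ j → digits (suc j)) (K + k) ≡⟨ cong (λ n → d -[1+ k ] + x * n) shift ⟩
  d -[1+ k ] + x * partialNumerator x d K k                  ∎
  where
  open ≡-Reasoning
  digits = λ j → d (+ j ℤ.- + suc k)
  shift = digitSum-cong x (K + k) (λ j → cong d (+[1+j]-+[1+k] j k))

partialSum-increasing : ∀ {x} d K → 0 < x → ∀ {m n} → m ≤ n → partialSum x d K m ℚ.≤ partialSum x d K n
partialSum-increasing {x} d K 0<x =
  stepwise⇒monotone {_∼_ = ℚ._≤_} ℚP.≤-refl ℚP.≤-trans (partialSum x d K) step
  where
  step : ∀ k → partialSum x d K k ℚ.≤ partialSum x d K (suc k)
  step k = divℚ-≤-* 0<x (^-pos 0<x k)
    (subst (x * partialNumerator x d K k ≤_) (sym (partialNumerator-suc x d K k)) (m≤n+m _ _))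

module _ {b} (1<b : 1 < b) (d : ℤ → ℕ) (K : ℕ) where

  private
    0<b = <-trans z<s 1<b

  upperSum-step : ∀ k → d -[1+ k ] < b → upperSum b d K (suc k) ℚ.≤ upperSum b d K k
  upperSum-step k digit<b = divℚ-*-≤ 0<b (^-pos 0<b k)
    (subst (λ A → suc A ≤ b * suc (partialNumerator b d K k)) (sym (partialNumerator-suc b d K k))
      (+b*≤b*suc (partialNumerator b d K k) digit<b))

  upperSum-step-< : ∀ k → suc (d -[1+ k ]) < b → upperSum b d K (suc k) ℚ.< upperSum b d K k
  upperSum-step-< k digit+1<b = divℚ-*-< 0<b (^-pos 0<b k)
    (subst (λ A → suc A < b * suc (partialNumerator b d K k)) (sym (partialNumerator-suc b d K k))
      (+b*≤b*suc (partialNumerator b d K k) digit+1<b))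

  upperSum-decreasing : (∀ i → d i < b) → ∀ {m n} → m ≤ n → upperSum b d K n ℚ.≤ upperSum b d K m
  upperSum-decreasing digits<b =
    stepwise⇒monotone {_∼_ = λ p q → q ℚ.≤ p} ℚP.≤-refl (λ p q → ℚP.≤-trans q p)
    (upperSum b d K) (λ k → upperSum-step k (digits<b -[1+ k ]))

partialSum≤upperSum : ∀ {x} d K → 0 < x → ∀ k → partialSum x d K k ℚ.≤ upperSum x d K k
partialSum≤upperSum {x} d K 0<x k =
  divℚ-≤ (^-pos 0<x k) (^-pos 0<x k) (*-monoˡ-≤ (x ^ k) (n≤1+n (partialNumerator x d K k)))

module _ {b} (1<b : 1 < b) {x : ℚ} {d : ℤ → ℕ} {K : ℕ} (normal : IsNormalExpansion b x d K) where

  private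
    0<b = <-trans z<s 1<b
    digits<b = proj₁ normal
    converges = proj₁ (proj₂ (proj₂ normal))
    notTrailing = proj₂ (proj₂ (proj₂ normal))

  partialSum≤ : ∀ k → partialSum b d K k ℚ.≤ x
  partialSum≤ k = ≤-limit converges k (λ _ k≤k′ → partialSum-increasing d K 0<b k≤k′)

  ≤upperSum : ∀ k → x ℚ.≤ upperSum b d K k
  ≤upperSum k = limit-≤ converges k (λ k′ k≤k′ →
    ℚP.≤-trans (partialSum≤upperSum d K 0<b k′) (upperSum-decreasing 1<b d K digits<b k≤k′))

  <upperSum : ∀ k → x ℚ.< upperSum b d K k
  <upperSum k with x ℚP.<? upperSum b d K k
  ... | yes x<U = x<U
  ... | no  x≮U = ⊥-elim (notTrailing (suc k , trailing))
    where
    -- A digit below b ∸ 1 past position -k would push the upper sums strictly below x.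
    digit≡b-1 : ∀ j → k ≤ j → d -[1+ j ] ≡ b ∸ 1
    digit≡b-1 j k≤j with d -[1+ j ] ≟ b ∸ 1
    ... | yes ≡b-1 = ≡b-1
    ... | no  digit≢b-1 = ⊥-elim (ℚP.<-irrefl refl (begin-strict
      x                          ≤⟨ ≤upperSum (suc j) ⟩
      upperSum b d K (suc j)     <⟨ upperSum-step-< 1<b d K j digit+1<b ⟩
      upperSum b d K j           ≤⟨ upperSum-decreasing 1<b d K digits<b k≤j ⟩
      upperSum b d K k           ≤⟨ ℚP.≮⇒≥ x≮U ⟩
      x                          ∎))
      where
      open ℚP.≤-Reasoning
      digit+1<b = ≤∧≢⇒< (digits<b -[1+ j ]) (λ digit+1≡b → digit≢b-1 (cong (_∸ 1) digit+1≡b))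
    trailing : ∀ i → i ℤ.≤ ℤ.- + suc k → d i ≡ b ∸ 1
    trailing -[1+ j ] (ℤ.-≤- k≤j) = digit≡b-1 j k≤j

  partialNumerator-floor : ∀ k F → divℚ F (b ^ k) ℚ.≤ x → x ℚ.< divℚ (suc F) (b ^ k) →
    partialNumerator b d K k ≡ F
  partialNumerator-floor k F F≤x x<F+1 = ≤-antisym
    (divℚ-floor-≤ (^-pos 0<b k) (partialSum≤ k) x<F+1)
    (divℚ-floor-≤ (^-pos 0<b k) F≤x (<upperSum k))

periodicValue : (x s t n u m : ℕ) → ℚ
periodicValue x s t n u m = natℚ n ℚ.+ divℚ u (x ^ s) ℚ.+ divℚ m (x ^ s * (x ^ t ∸ 1))

^-+-* : ∀ x s t j → x ^ (s + t * j) ≡ x ^ s * (x ^ t) ^ j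
^-+-* x s t j = trans (^-distribˡ-+-* x s (t * j)) (cong (x ^ s *_) (sym (^-*-assoc x t j)))

periodicValue-truncation : ∀ {x} s t n u m → 0 < x → 0 < x ^ t ∸ 1 → ∀ j →
  divℚ (affineIterate (x ^ t) m (n * x ^ s + u) j) (x ^ (s + t * j)) ℚ.+ divℚ m (x ^ (s + t * j) * (x ^ t ∸ 1))
    ≡ periodicValue x s t n u m
periodicValue-truncation {x} s t n u m 0<x 0<Q j = begin
  divℚ F (x ^ (s + t * j)) ℚ.+ divℚ m (x ^ (s + t * j) * Q) ≡⟨ divℚ-+-refine F m 0<xᵏ 0<Q ⟩
  divℚ (F * Q + m) (x ^ (s + t * j) * Q)                   ≡⟨ divℚ-≡ (*-mono-< 0<xᵏ 0<Q) 0<xˢQ cross ⟩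
  divℚ (F₀ * Q + m) (x ^ s * Q)                            ≡⟨ divℚ-+-refine F₀ m (^-pos 0<x s) 0<Q ⟨
  divℚ F₀ (x ^ s) ℚ.+ divℚ m (x ^ s * Q)                   ≡⟨ cong (ℚ._+ divℚ m (x ^ s * Q)) mixed ⟨
  periodicValue x s t n u m                                ∎
  where
  open ≡-Reasoning
  Q = x ^ t ∸ 1
  F₀ = n * x ^ s + u
  F = affineIterate (x ^ t) m F₀ j
  0<xᵏ = ^-pos 0<x (s + t * j)
  mixed = natℚ-+-divℚ n u (^-pos 0<x s)
  0<xˢQ = *-mono-< (^-pos 0<x s) 0<Q
  xᵗ≡1+Q : x ^ t ≡ suc Q
  xᵗ≡1+Q = trans (sym (m∸n+n≡m (≤-trans 0<Q (m∸n≤m (x ^ t) 1)))) (+-comm Q 1)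
  cross : (F * Q + m) * (x ^ s * Q) ≡ (F₀ * Q + m) * (x ^ (s + t * j) * Q)
  cross = begin
    (F * Q + m) * (x ^ s * Q)                   ≡⟨ cong (_* (x ^ s * Q)) (affineIterate-closed m F₀ j xᵗ≡1+Q) ⟩
    (F₀ * Q + m) * (x ^ t) ^ j * (x ^ s * Q)    ≡⟨ solve 4 (λ N T X Q → N :* T :* (X :* Q) := N :* (X :* T :* Q))
                                                      refl (F₀ * Q + m) ((x ^ t) ^ j) (x ^ s) Q ⟩
    (F₀ * Q + m) * (x ^ s * (x ^ t) ^ j * Q)    ≡⟨ cong (λ W → (F₀ * Q + m) * (W * Q)) (^-+-* x s t j) ⟨
    (F₀ * Q + m) * (x ^ (s + t * j) * Q)        ∎

module _ {b β : ℕ} (1<b : 1 < b) (1<β : 1 < β) {s t n u m : ℕ}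
         (u<bˢ : u < b ^ s) (m<Q : m < b ^ t ∸ 1)
         {d : ℤ → ℕ} {K : ℕ} (normal : IsNormalExpansion b (periodicValue b s t n u m) d K) where

  private
    0<b = <-trans z<s 1<b
    0<β = <-trans z<s 1<β
    c = cNat b β
    Q = b ^ t ∸ 1
    Q′ = β ^ t ∸ 1
    0<Q = ≤-<-trans z≤n m<Q
    0<t = 0<xᵗ∸1⇒0<t t 0<Q
    0<Q′ = 0<xᵗ∸1 1<β 0<t
    m<bᵗ = <-≤-trans m<Q (m∸n≤m (b ^ t) 1)
    q = periodicValue b s t n u m
    C = periodicValue β s t (c n) (c u) (c m)

    level : ℕ → ℕ
    level j = s + t * j

    F : ℕ → ℕ
    F = affineIterate (b ^ t) m (n * b ^ s + u)

    G : ℕ → ℕ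
    G = affineIterate (β ^ t) (c m) (c n * β ^ s + c u)

    gap : ℕ → ℚ
    gap j = divℚ (c m) (β ^ level j * Q′)

  q-at-level : ∀ j → q ≡ divℚ (F j * Q + m) (b ^ level j * Q)
  q-at-level j = trans (sym (periodicValue-truncation s t n u m 0<b 0<Q j))
                       (divℚ-+-refine (F j) m (^-pos 0<b (level j)) 0<Q)

  partialNumerator-at-level : ∀ j → partialNumerator b d K (level j) ≡ F j
  partialNumerator-at-level j = partialNumerator-floor 1<b normal (level j) (F j)
    (subst (divℚ (F j) (b ^ level j) ℚ.≤_) (sym (q-at-level j)) (divℚ-≤-refine (F j) m 0<bᵏ 0<Q))
    (subst (ℚ._< divℚ (suc (F j)) (b ^ level j)) (sym (q-at-level j)) (divℚ-refine-< (F j) m 0<bᵏ m<Q))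
    where 0<bᵏ = ^-pos 0<b (level j)

  cValue-at-level : ∀ j → partialSum β d K (level j) ℚ.+ gap j ≡ C
  cValue-at-level j = trans (cong (λ N → divℚ N (β ^ level j) ℚ.+ gap j) numerator)
                            (periodicValue-truncation s t (c n) (c u) (c m) 0<β 0<Q′ j)
    where
    open ≡-Reasoning
    digits<b = λ _ → proj₁ normal _
    numerator : partialNumerator β d K (level j) ≡ G j
    numerator = begin
      partialNumerator β d K (level j)                ≡⟨ cNat-digitSum b β 1<b _ (K + level j) digits<b ⟨
      c (partialNumerator b d K (level j))            ≡⟨ cong c (partialNumerator-at-level j) ⟩
      c (F j)                                         ≡⟨ cNat-affineIterate β 1<b {t} (n * b ^ s + u) m<bᵗ j ⟩
      affineIterate (β ^ t) (c m) (c (n * b ^ s + u)) j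
        ≡⟨ cong (λ F₀ → affineIterate (β ^ t) (c m) F₀ j) (cNat-concat b β 1<b s n u u<bˢ) ⟩
      G j                                             ∎

  private
    j≤level : ∀ j → j ≤ level j
    j≤level j = ≤-trans (m≤n*m j t {{>-nonZero 0<t}}) (m≤n+m (t * j) s)

    0≤gap : ∀ j → 0ℚ ℚ.≤ gap j
    0≤gap j = divℚ-≤ {0} {1} z<s (*-mono-< (^-pos 0<β (level j)) 0<Q′) z≤n

    j≤denominator : ∀ j → j ≤ β ^ level j * Q′
    j≤denominator j = begin
      j                   ≤⟨ <⇒≤ (n<xⁿ 1<β j) ⟩
      β ^ j               ≤⟨ ^-monoʳ-≤ β {{>-nonZero 0<β}} (j≤level j) ⟩
      β ^ level j         ≤⟨ m≤m*n (β ^ level j) Q′ {{>-nonZero 0<Q′}} ⟩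
      β ^ level j * Q′    ∎
      where open ≤-Reasoning

  partialSum≤cValue : ∀ k → partialSum β d K k ℚ.≤ C
  partialSum≤cValue k = begin
    partialSum β d K k                          ≤⟨ partialSum-increasing d K 0<β (j≤level k) ⟩
    partialSum β d K (level k)                  ≡⟨ ℚP.+-identityʳ _ ⟨
    partialSum β d K (level k) ℚ.+ 0ℚ           ≤⟨ ℚP.+-monoʳ-≤ (partialSum β d K (level k)) (0≤gap k) ⟩
    partialSum β d K (level k) ℚ.+ gap k        ≡⟨ cValue-at-level k ⟩
    C                                           ∎
    where open ℚP.≤-Reasoning

  cValue-approached : ∀ ε → 0ℚ ℚ.< ε → ∃ λ N → C ℚ.- partialSum β d K N ℚ.< ε
  cValue-approached ε 0<ε with divℚ-archimedean (c m) ε 0<ε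
  ... | D₀ , small = level D₀ , subst (ℚ._< ε) (sym C-P≡gap) (small (j≤denominator D₀))
    where
    C-P≡gap : C ℚ.- partialSum β d K (level D₀) ≡ gap D₀
    C-P≡gap = trans (cong (ℚ._- partialSum β d K (level D₀)) (sym (cValue-at-level D₀)))
                    (xyx⁻¹≈y (partialSum β d K (level D₀)) (gap D₀))

  partialSum-converges-to-cValue : ConvergesTo (partialSum β d K) C
  partialSum-converges-to-cValue =
    increasing-bounded⇒ConvergesTo (partialSum-increasing d K 0<β) partialSum≤cValue cValue-approached

lemma7p3 : (b β : ℕ) → 2 ℕ.≤ b → 2 ℕ.≤ β →
    (q : ℚ) → 0ℚ ℚ.≤ q →
    (s t n u m : ℕ) →
    IsS b q s → IsT b q s t →
    ℚ.floor q ≡ + n →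
    u ℕ.< b ^ s → m ℕ.< b ^ t ∸ 1 →
    q ≡ natℚ n ℚ.+ divℚ u (b ^ s) ℚ.+ divℚ m (b ^ s ℕ.* (b ^ t ∸ 1)) →
    HasCValue b β q
      (natℚ (cNat b β n) ℚ.+ divℚ (cNat b β u) (β ^ s)
        ℚ.+ divℚ (cNat b β m) (β ^ s ℕ.* (β ^ t ∸ 1)))
lemma7p3 b β 1<b 1<β q _ s t n u m _ _ _ u<bˢ m<bᵗ-1 refl d K normal =
  partialSum-converges-to-cValue 1<b 1<β {s} {t} {n} {u} {m} u<bˢ m<bᵗ-1 normal
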